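{- Let $k\ge1$. The graph $kC_3$ (the disjoint union of $k$ triangles) is $k$-super graceful if and only if $k=1$.
   Context: For integers $a\le b$, $[a,b]$ is the set of integers between $a$ and $b$ inclusive. For $k\ge 1$, a $k$-super graceful labeling of a graph $G=(V,E)$ with $p$ vertices and $q$ edges is a bijection $f:V\cup E\to[k,k+p+q-1]$ with $f(uv)=|f(u)-f(v)|$ for every edge $uv$; $G$ is $k$-super graceful if it admits one. -}

module Defs where

open import Data.Nat using (ℕ; _+_; _∸_; _≤_; _*_)
open import Data.Fin using (Fin; zero; suc)
open import Data.Product using (_×_; _,_; Σ; proj₁; proj₂; ∃)
open import Data.Sum using (_⊎_; inj₁; inj₂)
open import Relation.Binary.PropositionalEquality using (_≡_)

record Graph : Set₁ where
  field
    V    : Set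
    E    : Set
    ends : E → V × V

∣_-_∣ : ℕ → ℕ → ℕ
∣ a - b ∣ = (a ∸ b) + (b ∸ a)

-- k-super graceful labeling of G with p vertices and q edges:
-- a bijection f : V ⊎ E → [k, k+p+q-1] with f(uv) = |f(u) - f(v)|.
record SuperGracefulLabeling (k p q : ℕ) (G : Graph) : Set where
  open Graph G
  field
    f        : V ⊎ E → ℕ
    inRange  : ∀ x → k ≤ f x × f x ≤ k + p + q ∸ 1
    injective : ∀ x y → f x ≡ f y → x ≡ y
    surjective : ∀ n → k ≤ n → n ≤ k + p + q ∸ 1 → ∃ λ x → f x ≡ n
    edgeLabel : ∀ e → f (inj₂ e) ≡ ∣ f (inj₁ (proj₁ (ends e))) - f (inj₁ (proj₂ (ends e))) ∣

next3 : Fin 3 → Fin 3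
next3 zero = suc zero
next3 (suc zero) = suc (suc zero)
next3 (suc (suc zero)) = zero

kC3 : ℕ → Graph
kC3 k = record
  { V = Fin k × Fin 3
  ; E = Fin k × Fin 3
  ; ends = λ { (i , j) → (i , j) , (i , next3 j) }
  }

-- kC3 has 3k vertices and 3k edges
IsKSuperGraceful : (k p q : ℕ) → Graph → Set
IsKSuperGraceful k p q G = SuperGracefulLabeling k p q G

module Submission where

-- For k = 1 the labeling (vertices 1, 4, 6; edges 3, 2, 5) is given explicitly.
--
-- For the converse let f be a k-super graceful labeling of kC₃, so its 6k labels
-- are the distinct numbers k, k+1, …, 7k-1.  In a triangle with vertex labels
-- a ≤ b ≤ c the edge labels are b-a, c-b and c-a, whence
--     4c = (sum of the six labels) + a + (c - b).
-- Summing over the triangles: 4·Σ(maxima) = Σ(all labels) + Σ(minima and top edges),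
-- where the maxima are k distinct labels and the minima with top edges are 2k
-- distinct labels.  Since n distinct naturals in [lo, M) sum to between
-- lo + … + (lo+n-1) and (M-n) + … + (M-1), this forces 60k² + 4k ≤ 56k² + 8k,
-- i.e. k ≤ 1.

open import Defs
open import Data.Nat using (ℕ; _≤_; _*_)
open import Function.Bundles using (_⇔_)
open import Relation.Binary.PropositionalEquality using (_≡_)

open import Data.Nat using (zero; suc; _+_; _∸_; _<_; z≤n; s≤s; _≟_)
open import Data.Nat.Properties
  using ( +-comm; +-assoc; +-identityʳ; *-identityˡ; *-zeroʳ; *-distribˡ-+
        ; ≤-reflexive; ≤-trans; ≤-antisym; ≤-total; n≤1+n; m≤m+n; ≤∧≢⇒<; suc-injective
        ; +-mono-≤; +-monoˡ-≤; *-monoʳ-≤; ∸-monoʳ-≤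
        ; +-cancelˡ-≤; +-cancelʳ-≤; *-cancelˡ-≤; *-cancelʳ-≤; ∸-cancelˡ-≡
        ; m≤n⇒m∸n≡0; m+n∸m≡n; m+n∸n≡m; m∸n+n≡m; m≤n⇒∃[o]m+o≡n
        ; module ≤-Reasoning )
open import Data.Nat.ListAction using (sum)
open import Data.Nat.ListAction.Properties using (sum-++)
open import Data.Nat.Tactic.RingSolver using (solve; solve-∀)
open import Data.Fin using (Fin; toℕ; fromℕ<; splitAt; join)
open import Data.Fin.Patterns using (0F; 1F; 2F; 3F; 4F; 5F)
open import Data.Fin.Properties using (toℕ<n; toℕ-injective; toℕ-fromℕ<; join-splitAt)
open import Data.List using (List; []; _∷_; map; length; allFin; cartesianProductWith)
open import Data.List.Properties using (length-map; length-++; length-tabulate)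
open import Data.List.Extrema.Nat using (max; xs≤max)
open import Data.List.Membership.Propositional using (_∈_)
open import Data.List.Membership.DecPropositional _≟_ using (_∈?_)
open import Data.List.Relation.Unary.All as All using (All)
open import Data.List.Relation.Unary.All.Properties
  using (─⁺; ¬Any⇒All¬) renaming (cartesianProductWith⁺ to All-cartesianProductWith⁺)
open import Data.List.Relation.Unary.Any using (here; there; _─_)
open import Data.List.Relation.Unary.Unique.Propositional using (Unique)
import Data.List.Relation.Unary.Unique.Propositional.Properties as Unique
open import Data.Product using (Σ; Σ-syntax; _×_; _,_; proj₁; proj₂)
open import Data.Sum using (_⊎_; inj₁; inj₂; [_,_])
import Data.Sum as Sum
open import Function using (_∘_; const)
open import Function.Bundles using (mk⇔)
open import Relation.Binary.PropositionalEquality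
  using (_≢_; refl; sym; trans; cong; cong₂; subst; setoid; module ≡-Reasoning)
open import Relation.Nullary using (yes; no)

∣-∣-comm : ∀ a b → ∣ a - b ∣ ≡ ∣ b - a ∣
∣-∣-comm a b = +-comm (a ∸ b) (b ∸ a)

∣m-m+n∣≡n : ∀ m n → ∣ m - m + n ∣ ≡ n
∣m-m+n∣≡n m n = cong₂ _+_ (m≤n⇒m∸n≡0 (m≤m+n m n)) (m+n∸m≡n m n)

-- Writing b = a + x
-- and c = b + y, the edge labels are x, y and x + y and the identity is polynomial.
sortedSplit : ∀ {a b c} → a ≤ b → b ≤ c →
  4 * c ≡ ((a + b + c) + (∣ a - b ∣ + ∣ b - c ∣ + ∣ c - a ∣)) + (a + ∣ b - c ∣)
sortedSplit {a} a≤b b≤c with m≤n⇒∃[o]m+o≡n a≤b | m≤n⇒∃[o]m+o≡n b≤c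
... | x , refl | y , refl
  rewrite ∣m-m+n∣≡n a x | ∣m-m+n∣≡n (a + x) y | ∣-∣-comm (a + x + y) a
        | +-assoc a x y | ∣m-m+n∣≡n a (x + y) = solve (a ∷ x ∷ y ∷ [])

IsTriangle : (Fin 3 → ℕ) → (Fin 3 → ℕ) → Set
IsTriangle g h = ∀ j → h j ≡ ∣ g j - g (next3 j) ∣

Σ3 : (Fin 3 → ℕ) → ℕ
Σ3 g = g 0F + g 1F + g 2F

TriangleSplit : (Fin 3 → ℕ) → (Fin 3 → ℕ) → Set
TriangleSplit g h =
  Σ[ hi ∈ Fin 3 ] Σ[ lo ∈ Fin 3 ] Σ[ t ∈ Fin 3 ] 4 * g hi ≡ (Σ3 g + Σ3 h) + (g lo + h t)

increasingSplit : ∀ g h → IsTriangle g h → g 0F ≤ g 1F → g 1F ≤ g 2F → TriangleSplit g h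
increasingSplit g h tri p q = 2F , 0F , 1F , split
  where
  split : 4 * g 2F ≡ (Σ3 g + Σ3 h) + (g 0F + h 1F)
  split rewrite tri 0F | tri 1F | tri 2F = sortedSplit p q

Σ3-rotate : ∀ g → Σ3 (g ∘ next3) ≡ Σ3 g
Σ3-rotate g = rotate3 (g 0F) (g 1F) (g 2F)
  where
  rotate3 : ∀ a b c → b + c + a ≡ a + b + c
  rotate3 = solve-∀

-- The reflection of the triangle fixing vertex 0, and the induced map on edges.
mirrorV mirrorE : Fin 3 → Fin 3
mirrorV 0F = 0F
mirrorV 1F = 2F
mirrorV 2F = 1F
mirrorE 0F = 2F
mirrorE 1F = 1F
mirrorE 2F = 0F

Σ3-mirror : ∀ g h → Σ3 (g ∘ mirrorV) + Σ3 (h ∘ mirrorE) ≡ Σ3 g + Σ3 h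
Σ3-mirror g h = mirror3 (g 0F) (g 1F) (g 2F) (h 0F) (h 1F) (h 2F)
  where
  mirror3 : ∀ a b c u v w → (a + c + b) + (w + v + u) ≡ (a + b + c) + (u + v + w)
  mirror3 = solve-∀

rotateSplit : ∀ g h → TriangleSplit (g ∘ next3) (h ∘ next3) → TriangleSplit g h
rotateSplit g h (hi , lo , t , eq) =
  next3 hi , next3 lo , next3 t ,
  trans eq (cong (_+ (g (next3 lo) + h (next3 t))) (cong₂ _+_ (Σ3-rotate g) (Σ3-rotate h)))

mirrorSplit : ∀ g h → TriangleSplit (g ∘ mirrorV) (h ∘ mirrorE) → TriangleSplit g h
mirrorSplit g h (hi , lo , t , eq) =
  mirrorV hi , mirrorV lo , mirrorE t ,
  trans eq (cong (_+ (g (mirrorV lo) + h (mirrorE t))) (Σ3-mirror g h))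

rotateTriangle : ∀ g h → IsTriangle g h → IsTriangle (g ∘ next3) (h ∘ next3)
rotateTriangle g h tri = tri ∘ next3

mirrorTriangle : ∀ g h → IsTriangle g h → IsTriangle (g ∘ mirrorV) (h ∘ mirrorE)
mirrorTriangle g h tri 0F = trans (tri 2F) (∣-∣-comm (g 2F) (g 0F))
mirrorTriangle g h tri 1F = trans (tri 1F) (∣-∣-comm (g 1F) (g 2F))
mirrorTriangle g h tri 2F = trans (tri 0F) (∣-∣-comm (g 0F) (g 1F))

-- Splits exist when vertex 0 carries the smallest label: up to mirroring, the
-- labels increase along 0, 1, 2.
minimumAt0 : ∀ g h → IsTriangle g h → g 0F ≤ g 1F → g 0F ≤ g 2F → TriangleSplit g h
minimumAt0 g h tri p q with ≤-total (g 1F) (g 2F)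
... | inj₁ r = increasingSplit g h tri p r
... | inj₂ r = mirrorSplit g h (increasingSplit (g ∘ mirrorV) (h ∘ mirrorE) (mirrorTriangle g h tri) q r)

-- Minimum at vertex 1 or 2: rotate it to vertex 0.
minimumAt1 : ∀ g h → IsTriangle g h → g 1F ≤ g 2F → g 1F ≤ g 0F → TriangleSplit g h
minimumAt1 g h tri p q = rotateSplit g h (minimumAt0 (g ∘ next3) (h ∘ next3) (rotateTriangle g h tri) p q)

minimumAt2 : ∀ g h → IsTriangle g h → g 2F ≤ g 0F → g 2F ≤ g 1F → TriangleSplit g h
minimumAt2 g h tri p q = rotateSplit g h (minimumAt1 (g ∘ next3) (h ∘ next3) (rotateTriangle g h tri) p q)

triangleSplit : ∀ g h → IsTriangle g h → TriangleSplit g h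
triangleSplit g h tri with ≤-total (g 0F) (g 1F) | ≤-total (g 0F) (g 2F) | ≤-total (g 1F) (g 2F)
... | inj₁ p | inj₁ q | _      = minimumAt0 g h tri p q
... | inj₁ p | inj₂ q | _      = minimumAt2 g h tri q (≤-trans q p)
... | inj₂ p | _      | inj₁ q = minimumAt1 g h tri q p
... | inj₂ p | _      | inj₂ q = minimumAt2 g h tri (≤-trans q p) q

module DistinctSums where
  open import Data.List.Relation.Unary.All using ([]; _∷_)
  open import Data.List.Relation.Unary.AllPairs using ([]; _∷_)

  sum-─ : ∀ {x : ℕ} {xs} (p : x ∈ xs) → sum xs ≡ x + sum (xs ─ p)
  sum-─ (here refl) = refl
  sum-─ {x} (there {y} p) = trans (cong (y +_) (sum-─ p)) (+-comm₃ y x _)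
    where
    +-comm₃ : ∀ a b c → a + (b + c) ≡ b + (a + c)
    +-comm₃ = solve-∀

  length-─ : ∀ {A : Set} {x : A} {xs} (p : x ∈ xs) → length xs ≡ suc (length (xs ─ p))
  length-─ (here refl) = refl
  length-─ (there p) = cong suc (length-─ p)

  unique-─ : ∀ {A : Set} {x : A} {xs} (p : x ∈ xs) → Unique xs → Unique (xs ─ p)
  unique-─ (here _) (_ ∷ u) = u
  unique-─ (there p) (a ∷ u) = ─⁺ p a ∷ unique-─ p u

  removed-distinct : ∀ {A : Set} {x : A} {xs} (p : x ∈ xs) → Unique xs → All (x ≢_) (xs ─ p)
  removed-distinct (here refl) (a ∷ _) = a
  removed-distinct (there p) (a ∷ u) = (λ e → All.lookup a p (sym e)) ∷ removed-distinct p u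

  below-avoiding : ∀ {M xs} → All (_< suc M) xs → All (M ≢_) xs → All (_< M) xs
  below-avoiding [] [] = []
  below-avoiding (s≤s x≤M ∷ bs) (M≢x ∷ ds) = ≤∧≢⇒< x≤M (λ e → M≢x (sym e)) ∷ below-avoiding bs ds

  upper-step : ∀ M r s → 2 * s + r * suc r ≤ 2 * r * M →
    2 * (M + s) + suc r * suc (suc r) ≤ 2 * suc r * suc M
  upper-step M r s ih = begin
    2 * (M + s) + suc r * suc (suc r)             ≡⟨ split-left M r s ⟩
    (2 * s + r * suc r) + (2 * M + 2 * r + 2)     ≤⟨ +-monoˡ-≤ (2 * M + 2 * r + 2) ih ⟩
    2 * r * M + (2 * M + 2 * r + 2)               ≡⟨ split-right M r ⟩
    2 * suc r * suc M                             ∎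
    where
    open ≤-Reasoning
    split-left : ∀ M r s → 2 * (M + s) + suc r * suc (suc r) ≡ (2 * s + r * suc r) + (2 * M + 2 * r + 2)
    split-left = solve-∀
    split-right : ∀ M r → 2 * r * M + (2 * M + 2 * r + 2) ≡ 2 * suc r * suc M
    split-right = solve-∀

  -- n distinct naturals below M sum to at most (M-1) + (M-2) + ... + (M-n),
  -- i.e. 2 · sum + n(n+1) ≤ 2nM.  Induction on M: if M-1 occurs, remove it.
  sum-distinct-below : ∀ M xs → Unique xs → All (_< M) xs →
    2 * sum xs + length xs * suc (length xs) ≤ 2 * length xs * M
  sum-distinct-below zero [] _ _ = z≤n
  sum-distinct-below zero (_ ∷ _) _ (() ∷ _)
  sum-distinct-below (suc M) xs u bs with M ∈? xs
  ... | no M∉xs =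
    ≤-trans (sum-distinct-below M xs u (below-avoiding bs (¬Any⇒All¬ xs M∉xs)))
            (*-monoʳ-≤ (2 * length xs) (n≤1+n M))
  ... | yes p = begin
    2 * sum xs + length xs * suc (length xs)
      ≡⟨ cong₂ (λ s n → 2 * s + n * suc n) (sum-─ p) (length-─ p) ⟩
    2 * (M + sum rest) + suc (length rest) * suc (suc (length rest))
      ≤⟨ upper-step M (length rest) (sum rest) (sum-distinct-below M rest (unique-─ p u) rest-below) ⟩
    2 * suc (length rest) * suc M
      ≡⟨ cong (λ n → 2 * n * suc M) (sym (length-─ p)) ⟩
    2 * length xs * suc M ∎
    where
    open ≤-Reasoning
    rest = xs ─ p
    rest-below : All (_< M) rest
    rest-below = below-avoiding (─⁺ p bs) (removed-distinct p u)

  reflect-unique : ∀ T xs → All (_≤ T) xs → Unique xs → Unique (map (T ∸_) xs)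
  reflect-unique T [] [] [] = []
  reflect-unique T (x ∷ xs) (x≤T ∷ bs) (ds ∷ u) = images bs ds ∷ reflect-unique T xs bs u
    where
    images : ∀ {ys} → All (_≤ T) ys → All (x ≢_) ys → All ((T ∸ x) ≢_) (map (T ∸_) ys)
    images [] [] = []
    images (y≤T ∷ bs) (x≢y ∷ ds) = (λ e → x≢y (∸-cancelˡ-≡ x≤T y≤T e)) ∷ images bs ds

  sum-reflect : ∀ T xs → All (_≤ T) xs → sum (map (T ∸_) xs) + sum xs ≡ length xs * T
  sum-reflect T [] [] = refl
  sum-reflect T (x ∷ xs) (x≤T ∷ bs) = begin
    (T ∸ x + sum (map (T ∸_) xs)) + (x + sum xs)   ≡⟨ interchange (T ∸ x) _ x _ ⟩
    (T ∸ x + x) + (sum (map (T ∸_) xs) + sum xs)   ≡⟨ cong₂ _+_ (m∸n+n≡m x≤T) (sum-reflect T xs bs) ⟩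
    T + length xs * T                              ∎
    where
    open ≡-Reasoning
    interchange : ∀ a b c d → (a + b) + (c + d) ≡ (a + c) + (b + d)
    interchange = solve-∀

  -- n distinct naturals ≥ lo sum to at least lo + (lo+1) + ... + (lo+n-1),
  -- i.e. 2n·lo + n² ≤ 2 · sum + n.  Reflect the list below its maximum B and
  -- apply sum-distinct-below.
  sum-distinct-above : ∀ lo xs → Unique xs → All (lo ≤_) xs →
    2 * length xs * lo + length xs * length xs ≤ 2 * sum xs + length xs
  sum-distinct-above lo xs u as = +-cancelʳ-≤ (2 * n * B + n) _ _ (begin
    (2 * n * lo + n * n) + (2 * n * B + n)   ≡⟨ regroup n lo B ⟩
    2 * (n * T) + n * suc n                  ≡⟨ cong (λ s → 2 * s + n * suc n) (sym (sum-reflect T xs below-T)) ⟩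
    2 * (sum rs + sum xs) + n * suc n        ≡⟨ shuffle (sum rs) (sum xs) (n * suc n) ⟩
    (2 * sum rs + n * suc n) + 2 * sum xs    ≤⟨ +-monoˡ-≤ (2 * sum xs) reflected-bound ⟩
    2 * n * suc B + 2 * sum xs               ≡⟨ spread n B (sum xs) ⟩
    (2 * sum xs + n) + (2 * n * B + n)       ∎)
    where
    open ≤-Reasoning
    n = length xs
    B = max 0 xs
    T = B + lo
    rs = map (T ∸_) xs
    below-T : All (_≤ T) xs
    below-T = All.map (λ x≤B → ≤-trans x≤B (m≤m+n B lo)) (xs≤max 0 xs)
    rs-below : ∀ ys → All (lo ≤_) ys → All (_< suc B) (map (T ∸_) ys)
    rs-below [] [] = []
    rs-below (_ ∷ ys) (lo≤y ∷ as) = s≤s (≤-trans (∸-monoʳ-≤ T lo≤y) (≤-reflexive (m+n∸n≡m B lo))) ∷ rs-below ys as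
    reflected-bound : 2 * sum rs + n * suc n ≤ 2 * n * suc B
    reflected-bound = subst (λ m → 2 * sum rs + m * suc m ≤ 2 * m * suc B) (length-map (T ∸_) xs)
      (sum-distinct-below (suc B) rs (reflect-unique T xs below-T u) (rs-below xs as))
    regroup : ∀ n lo B → (2 * n * lo + n * n) + (2 * n * B + n) ≡ 2 * (n * (B + lo)) + n * suc n
    regroup = solve-∀
    shuffle : ∀ a b c → 2 * (a + b) + c ≡ (2 * a + c) + 2 * b
    shuffle = solve-∀
    spread : ∀ n B s → 2 * n * suc B + 2 * s ≡ (2 * s + n) + (2 * n * B + n)
    spread = solve-∀

open DistinctSums using (sum-distinct-below; sum-distinct-above)

sum-cartesianProductWith : ∀ {A B : Set} (F : A → B → ℕ) xs ys →
  sum (cartesianProductWith F xs ys) ≡ sum (map (λ x → sum (map (F x) ys)) xs)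
sum-cartesianProductWith F [] ys = refl
sum-cartesianProductWith F (x ∷ xs) ys =
  trans (sum-++ (map (F x) ys) _) (cong (sum (map (F x) ys) +_) (sum-cartesianProductWith F xs ys))

length-cartesianProductWith : ∀ {A B C : Set} (F : A → B → C) xs ys →
  length (cartesianProductWith F xs ys) ≡ length xs * length ys
length-cartesianProductWith F [] ys = refl
length-cartesianProductWith F (x ∷ xs) ys =
  trans (length-++ (map (F x) ys)) (cong₂ _+_ (length-map (F x) ys) (length-cartesianProductWith F xs ys))

sum-map-combination : ∀ {A : Set} c (G H K : A → ℕ) → (∀ a → c * G a ≡ H a + K a) →
  ∀ xs → c * sum (map G xs) ≡ sum (map H xs) + sum (map K xs)
sum-map-combination c G H K eq [] = *-zeroʳ c
sum-map-combination c G H K eq (x ∷ xs) = begin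
  c * (G x + sum (map G xs))                         ≡⟨ *-distribˡ-+ c (G x) _ ⟩
  c * G x + c * sum (map G xs)                       ≡⟨ cong₂ _+_ (eq x) (sum-map-combination c G H K eq xs) ⟩
  (H x + K x) + (sum (map H xs) + sum (map K xs))    ≡⟨ interchange (H x) (K x) _ _ ⟩
  (H x + sum (map H xs)) + (K x + sum (map K xs))    ∎
  where
  open ≡-Reasoning
  interchange : ∀ a b c d → (a + b) + (c + d) ≡ (a + c) + (b + d)
  interchange = solve-∀

injective₂ : ∀ {A B X : Set} (c : A → B → X) (p : X → A) (q : X → B) →
  (∀ a b → p (c a b) ≡ a) → (∀ a b → q (c a b) ≡ b) →
  ∀ {a a′ b b′} → c a b ≡ c a′ b′ → a ≡ a′ × b ≡ b′
injective₂ c p q pc qc {a} {a′} {b} {b′} e =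
  trans (sym (pc a b)) (trans (cong p e) (pc a′ b′)) ,
  trans (sym (qc a b)) (trans (cong q e) (qc a′ b′))

-- The numerical heart of the obstruction: with M = 7k, the three bounds together
-- with 4c = t + a force 60k² + 4k ≤ 56k² + 8k, i.e. k² ≤ k.
square-bound : ∀ k c t a → 4 * c ≡ t + a →
  2 * c + (k * 1) * suc (k * 1) ≤ 2 * (k * 1) * (k + 3 * k + 3 * k) →
  2 * (k * 6) * k + (k * 6) * (k * 6) ≤ 2 * t + k * 6 →
  2 * (k * 2) * k + (k * 2) * (k * 2) ≤ 2 * a + k * 2 →
  k * k ≤ k
square-bound k c t a eq top-bound all-bound low-bound =
  *-cancelˡ-≤ 4 (+-cancelˡ-≤ (56 * (k * k) + 4 * k) _ _ (begin
    (56 * (k * k) + 4 * k) + 4 * (k * k)                        ≡⟨ expand-left k ⟩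
    (L₆ + L₂) + 4 * Q                                           ≤⟨ +-monoˡ-≤ (4 * Q) (+-mono-≤ all-bound low-bound) ⟩
    ((2 * t + k * 6) + (2 * a + k * 2)) + 4 * Q                 ≡⟨ collect t a k Q ⟩
    2 * (t + a) + (8 * k + 4 * Q)                               ≡⟨ cong (λ s → 2 * s + (8 * k + 4 * Q)) (sym eq) ⟩
    2 * (4 * c) + (8 * k + 4 * Q)                               ≡⟨ factor c k Q ⟩
    4 * (2 * c + Q) + 8 * k                                     ≤⟨ +-monoˡ-≤ (8 * k) (*-monoʳ-≤ 4 top-bound) ⟩
    4 * (2 * (k * 1) * (k + 3 * k + 3 * k)) + 8 * k             ≡⟨ expand-right k ⟩
    (56 * (k * k) + 4 * k) + 4 * k                              ∎))
  where
  open ≤-Reasoning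
  Q  = (k * 1) * suc (k * 1)
  L₆ = 2 * (k * 6) * k + (k * 6) * (k * 6)
  L₂ = 2 * (k * 2) * k + (k * 2) * (k * 2)
  expand-left : ∀ k → (56 * (k * k) + 4 * k) + 4 * (k * k) ≡
    ((2 * (k * 6) * k + (k * 6) * (k * 6)) + (2 * (k * 2) * k + (k * 2) * (k * 2))) + 4 * ((k * 1) * suc (k * 1))
  expand-left = solve-∀
  collect : ∀ t a k q → ((2 * t + k * 6) + (2 * a + k * 2)) + 4 * q ≡ 2 * (t + a) + (8 * k + 4 * q)
  collect = solve-∀
  factor : ∀ c k q → 2 * (4 * c) + (8 * k + 4 * q) ≡ 4 * (2 * c + q) + 8 * k
  factor = solve-∀
  expand-right : ∀ k → 4 * (2 * (k * 1) * (k + 3 * k + 3 * k)) + 8 * k ≡ (56 * (k * k) + 4 * k) + 4 * k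
  expand-right = solve-∀

square≤⇒≤1 : ∀ k → k * k ≤ k → k ≤ 1
square≤⇒≤1 zero _ = z≤n
square≤⇒≤1 (suc k) le = *-cancelʳ-≤ (suc k) 1 (suc k) (subst (suc k * suc k ≤_) (sym (*-identityˡ (suc k))) le)

module Obstruction {n : ℕ} (L : SuperGracefulLabeling (suc n) (3 * suc n) (3 * suc n) (kC3 (suc n))) where
  open SuperGracefulLabeling L

  k M : ℕ
  k = suc n
  M = k + 3 * k + 3 * k

  Element : Set
  Element = (Fin k × Fin 3) ⊎ (Fin k × Fin 3)

  label-bounds : ∀ x → k ≤ f x × f x < M
  label-bounds x = proj₁ (inRange x) , s≤s (proj₂ (inRange x))

  triangleOf : Element → Fin k
  triangleOf = [ proj₁ , proj₁ ]

  record Selection (m : ℕ) : Set where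
    field
      cell          : Fin k → Fin m → Element
      slotOf        : Element → Fin m
      slot-cell     : ∀ i r → slotOf (cell i r) ≡ r
      triangle-cell : ∀ i r → triangleOf (cell i r) ≡ i

    labels : List ℕ
    labels = cartesianProductWith (λ i r → f (cell i r)) (allFin k) (allFin m)

    rowSum : Fin k → ℕ
    rowSum i = sum (map (λ r → f (cell i r)) (allFin m))

    labels-unique : Unique labels
    labels-unique = Unique.cartesianProductWith⁺ _
      (λ e → injective₂ cell triangleOf slotOf triangle-cell slot-cell (injective _ _ e))
      (Unique.allFin⁺ k) (Unique.allFin⁺ m)

    labels-length : length labels ≡ k * m
    labels-length = trans (length-cartesianProductWith _ (allFin k) (allFin m))
      (cong₂ _*_ (length-tabulate {n = k} (λ i → i)) (length-tabulate {n = m} (λ r → r)))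

    labels-sum : sum labels ≡ sum (map rowSum (allFin k))
    labels-sum = sum-cartesianProductWith _ (allFin k) (allFin m)

    labels-in : ∀ (P : ℕ → Set) → (∀ x → P (f x)) → All P labels
    labels-in P p = All-cartesianProductWith⁺ (setoid (Fin k)) (setoid (Fin m)) _ (allFin k) (allFin m) (λ _ _ → p _)

    upper : 2 * sum labels + (k * m) * suc (k * m) ≤ 2 * (k * m) * M
    upper = subst (λ l → 2 * sum labels + l * suc l ≤ 2 * l * M) labels-length
      (sum-distinct-below M labels labels-unique (labels-in (_< M) (proj₂ ∘ label-bounds)))

    lower : 2 * (k * m) * k + (k * m) * (k * m) ≤ 2 * sum labels + k * m
    lower = subst (λ l → 2 * l * k + l * l ≤ 2 * sum labels + l) labels-length
      (sum-distinct-above k labels labels-unique (labels-in (k ≤_) (proj₁ ∘ label-bounds)))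

  vertexLabel edgeLabelOf : Fin k → Fin 3 → ℕ
  vertexLabel i j = f (inj₁ (i , j))
  edgeLabelOf i j = f (inj₂ (i , j))

  split : ∀ i → TriangleSplit (vertexLabel i) (edgeLabelOf i)
  split i = triangleSplit (vertexLabel i) (edgeLabelOf i) (λ j → edgeLabel (i , j))

  -- The largest and smallest vertex and the top edge chosen by the split of triangle i.
  hi lo top : Fin k → Fin 3
  hi i  = proj₁ (split i)
  lo i  = proj₁ (proj₂ (split i))
  top i = proj₁ (proj₂ (proj₂ (split i)))

  -- All six elements of every triangle: vertices in slots 0–2, edges in slots 3–5.
  everything : Selection 6
  everything = record
    { cell          = λ i r → Sum.map (i ,_) (i ,_) (splitAt 3 r)
    ; slotOf        = join 3 3 ∘ Sum.map proj₂ proj₂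
    ; slot-cell     = λ i r → trans (cong (join 3 3) (position-of-map i (splitAt 3 r))) (join-splitAt 3 3 r)
    ; triangle-cell = λ i r → triangle-of-map i (splitAt 3 r)
    }
    where
    position-of-map : ∀ i (s : Fin 3 ⊎ Fin 3) → Sum.map proj₂ proj₂ (Sum.map (i ,_) (i ,_) s) ≡ s
    position-of-map i (inj₁ _) = refl
    position-of-map i (inj₂ _) = refl
    triangle-of-map : ∀ i (s : Fin 3 ⊎ Fin 3) → triangleOf (Sum.map (i ,_) (i ,_) s) ≡ i
    triangle-of-map i (inj₁ _) = refl
    triangle-of-map i (inj₂ _) = refl

  maxima : Selection 1
  maxima = record
    { cell          = λ i _ → inj₁ (i , hi i)
    ; slotOf        = const 0F
    ; slot-cell     = λ { i 0F → refl }
    ; triangle-cell = λ i _ → refl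
    }

  minima : Selection 2
  minima = record
    { cell          = λ { i 0F → inj₁ (i , lo i) ; i 1F → inj₂ (i , top i) }
    ; slotOf        = [ const 0F , const 1F ]
    ; slot-cell     = λ { i 0F → refl ; i 1F → refl }
    ; triangle-cell = λ { i 0F → refl ; i 1F → refl }
    }

  open Selection using (labels; rowSum; labels-sum; upper; lower)

  split-sum : 4 * sum (labels maxima) ≡ sum (labels everything) + sum (labels minima)
  split-sum rewrite labels-sum maxima | labels-sum everything | labels-sum minima =
    sum-map-combination 4 (rowSum maxima) (rowSum everything) (rowSum minima) row-split (allFin k)
    where
    rearrange : ∀ (g h : Fin 3 → ℕ) c l e → 4 * c ≡ (Σ3 g + Σ3 h) + (l + e) →
      4 * (c + 0) ≡ (g 0F + (g 1F + (g 2F + (h 0F + (h 1F + (h 2F + 0)))))) + (l + (e + 0))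
    rearrange g h c l e eq = trans (cong (4 *_) (+-identityʳ c))
      (trans eq (normalise (g 0F) (g 1F) (g 2F) (h 0F) (h 1F) (h 2F) l e))
      where
      normalise : ∀ a₀ a₁ a₂ b₀ b₁ b₂ l e →
        (a₀ + a₁ + a₂ + (b₀ + b₁ + b₂)) + (l + e) ≡ (a₀ + (a₁ + (a₂ + (b₀ + (b₁ + (b₂ + 0)))))) + (l + (e + 0))
      normalise = solve-∀
    row-split : ∀ i → 4 * rowSum maxima i ≡ rowSum everything i + rowSum minima i
    row-split i = rearrange (vertexLabel i) (edgeLabelOf i)
      (vertexLabel i (hi i)) (vertexLabel i (lo i)) (edgeLabelOf i (top i)) (proj₂ (proj₂ (proj₂ (split i))))

  k²≤k : k * k ≤ k
  k²≤k = square-bound k (sum (labels maxima)) (sum (labels everything)) (sum (labels minima))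
    split-sum (upper maxima) (lower everything) (lower minima)

-- One triangle with vertex labels 1, 4, 6 and edge labels 3, 2, 5: every value in
-- [1, 6] is used once.  Labels are encoded as 1 + (a position in Fin 6).
module OneTriangle where
  Element : Set
  Element = (Fin 1 × Fin 3) ⊎ (Fin 1 × Fin 3)

  code : Element → Fin 6
  code (inj₁ (0F , 0F)) = 0F
  code (inj₁ (0F , 1F)) = 3F
  code (inj₁ (0F , 2F)) = 5F
  code (inj₂ (0F , 0F)) = 2F
  code (inj₂ (0F , 1F)) = 1F
  code (inj₂ (0F , 2F)) = 4F

  decode : Fin 6 → Element
  decode 0F = inj₁ (0F , 0F)
  decode 1F = inj₂ (0F , 1F)
  decode 2F = inj₂ (0F , 0F)
  decode 3F = inj₁ (0F , 1F)
  decode 4F = inj₂ (0F , 2F)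
  decode 5F = inj₁ (0F , 2F)

  decode-code : ∀ x → decode (code x) ≡ x
  decode-code (inj₁ (0F , 0F)) = refl
  decode-code (inj₁ (0F , 1F)) = refl
  decode-code (inj₁ (0F , 2F)) = refl
  decode-code (inj₂ (0F , 0F)) = refl
  decode-code (inj₂ (0F , 1F)) = refl
  decode-code (inj₂ (0F , 2F)) = refl

  code-decode : ∀ r → code (decode r) ≡ r
  code-decode 0F = refl
  code-decode 1F = refl
  code-decode 2F = refl
  code-decode 3F = refl
  code-decode 4F = refl
  code-decode 5F = refl

  label : Element → ℕ
  label x = suc (toℕ (code x))

  labeling : SuperGracefulLabeling 1 (3 * 1) (3 * 1) (kC3 1)
  labeling = record
    { f          = label
    ; inRange    = λ x → s≤s z≤n , toℕ<n (code x)
    ; injective  = λ x y e → trans (sym (decode-code x))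
                               (trans (cong decode (toℕ-injective (suc-injective e))) (decode-code y))
    ; surjective = onto
    ; edgeLabel  = λ { (0F , 0F) → refl ; (0F , 1F) → refl ; (0F , 2F) → refl }
    }
    where
    onto : ∀ m → 1 ≤ m → m ≤ 6 → Σ Element λ x → label x ≡ m
    onto (suc m) _ m<6 = decode (fromℕ< m<6) ,
      cong suc (trans (cong toℕ (code-decode (fromℕ< m<6))) (toℕ-fromℕ< m<6))

theorem3p23 : (k : ℕ) → 1 ≤ k →
    (IsKSuperGraceful k (3 * k) (3 * k) (kC3 k) ⇔ k ≡ 1)
theorem3p23 (suc n) (s≤s z≤n) = mk⇔ only-one (λ { refl → OneTriangle.labeling })
  where
  only-one : IsKSuperGraceful (suc n) (3 * suc n) (3 * suc n) (kC3 (suc n)) → suc n ≡ 1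
  only-one L = ≤-antisym (square≤⇒≤1 (suc n) (Obstruction.k²≤k L)) (s≤s z≤n)
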